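{- Let $\delta\in(0,1)$, $\tilde K\ge1$, and consider a Non-strict Turnstile data stream over $[m]$ with at most $\tilde K$ elements. Let $\tau_0=\log_2\frac{\tilde K}{\delta}$, $\tau=5\tau_0$, $s=8\tilde K$, and let $h_1,\dots,h_\tau:[m]\to[s]$ be drawn independently from a pairwise independent family. Maintain $\tau$ arrays of $s$ bins, bin $b$ of array $a$ holding a Strict Bin Sketch of the substream of pairs $(x_i,c_i)$ with $h_a(x_i)=b$. Let $A$ be the set of pairs reported by the bins of the first $\tau_0$ arrays that pass the single-element test. Output every candidate $(k,c)\in A$ for which, in at least half of the remaining $\tau'=4\tau_0$ arrays $a$, bin $h_a(k)$ passes the single-element test and reports $(k,c)$. Then with probability at least $1-\delta$, the output set equals exactly the set of elements $(k,C_k)$ of the stream.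
   Context: A data stream is a sequence of pairs $(x_i,c_i)$ with $x_i\in[m]$ and integer $c_i$; $C_k=\sum_{i:x_i=k}c_i$, and the elements are the pairs $(k,C_k)$ with $C_k\neq0$. In the Non-strict Turnstile model total counts may be any integers, including negative. A Strict Bin Sketch of a substream $\{(x_i,c_i)\}_{i\in I}$ consists of the counters $X=\sum_{i\in I}c_i$, $Y=\sum_{i\in I}c_ix_i$, $Z=\sum_{i\in I}c_ix_i^2$; it passes the single-element test iff $X\neq0$, $Y\neq0$, $Z\neq0$ and $XZ=Y^2$, in which case it reports the pair $(Y/X,X)$. A pairwise independent family has values on any two distinct inputs independent and uniform. -}

module Defs where

open import Data.Nat as ℕ using (ℕ; zero; suc; _≤ᵇ_)
open import Data.Integer as ℤ using (ℤ; +_)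
open import Data.Rational as ℚ using (ℚ)
open import Data.Fin as Fin using (Fin; toℕ)
open import Data.Bool using (Bool; true; false; _∧_; if_then_else_)
open import Data.List using (List; []; _∷_; foldr)
open import Data.Vec using (Vec; lookup)
open import Data.Product using (_×_; _,_; ∃; ∃-syntax; Σ)
open import Relation.Nullary using (¬_; does)
open import Relation.Binary.PropositionalEquality using (_≡_; _≢_)

ℕtoℚ : ℕ → ℚ
ℕtoℚ n = (+ n) ℚ./ 1

countFin : (n : ℕ) → (Fin n → Bool) → ℕ
countFin zero    p = 0
countFin (suc n) p = (if p Fin.zero then 1 else 0) ℕ.+ countFin n (λ i → p (Fin.suc i))

-- a data stream over [m] = {1,…,m}: a list of pairs (x_i , c_i); key x : Fin m denotes toℕ x + 1
Stream : ℕ → Set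
Stream m = List (Fin m × ℤ)

keyℤ : {m : ℕ} → Fin m → ℤ
keyℤ k = + suc (toℕ k)

C : {m : ℕ} → Stream m → Fin m → ℤ
C S k = foldr (λ { (x , c) acc → if does (x Fin.≟ k) then c ℤ.+ acc else acc }) (+ 0) S

numElements : {m : ℕ} → Stream m → ℕ
numElements {m} S = countFin m (λ k → if does (C S k ℤ.≟ + 0) then false else true)

Hash : ℕ → ℕ → Set
Hash m s = Fin m → Fin s

-- pairwise independent family given as a finite multiset H(0..N-1), drawn uniformly:
-- values at every single point are uniform, and at any two distinct points independent and uniform
PairwiseIndependent : {m s N : ℕ} → (Fin N → Hash m s) → Set
PairwiseIndependent {m} {s} {N} H =
  (∀ (x : Fin m) (a : Fin s) →
     countFin N (λ i → does (H i x Fin.≟ a)) ℕ.* s ≡ N)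
  × (∀ (x y : Fin m) → x ≢ y → ∀ (a b : Fin s) →
     countFin N (λ i → does (H i x Fin.≟ a) ∧ does (H i y Fin.≟ b)) ℕ.* (s ℕ.* s) ≡ N)

record Sketch : Set where
  constructor sk
  field X Y Z : ℤ

binSketch : {m s : ℕ} → Hash m s → Stream m → Fin s → Sketch
binSketch h S b = foldr step (sk (+ 0) (+ 0) (+ 0)) S
  where
  step : _ → Sketch → Sketch
  step (x , c) (sk X Y Z) =
    if does (h x Fin.≟ b)
    then sk (c ℤ.+ X) (c ℤ.* keyℤ x ℤ.+ Y) (c ℤ.* keyℤ x ℤ.* keyℤ x ℤ.+ Z)
    else sk X Y Z

passes : Sketch → Bool
passes (sk X Y Z) =
  (if does (X ℤ.≟ + 0) then false else true) ∧
  (if does (Y ℤ.≟ + 0) then false else true) ∧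
  (if does (Z ℤ.≟ + 0) then false else true) ∧
  does (X ℤ.* Z ℤ.≟ Y ℤ.* Y)

-- the sketch passes the test and reports (Y/X , X) = (k , c), i.e. X = c and Y = k·X
reports : {m : ℕ} → Sketch → Fin m → ℤ → Bool
reports (sk X Y Z) k c =
  passes (sk X Y Z) ∧ does (X ℤ.≟ c) ∧ does (Y ℤ.≟ keyℤ k ℤ.* X)

-- the algorithm, with τ0 first arrays (indices < τ0) and 4τ0 remaining arrays (indices ≥ τ0)
-- candidate set A: pairs reported by passing bins of the first τ0 arrays
inA : {m s τ0 : ℕ} → (Fin (5 ℕ.* τ0) → Hash m s) → Stream m → Fin m → ℤ → Set
inA {m} {s} {τ0} g S k c =
  ∃[ a ] ∃[ b ] ((suc (toℕ a) ≤ᵇ τ0) ≡ true × reports (binSketch (g a) S b) k c ≡ true)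

confirmations : {m s τ0 : ℕ} → (Fin (5 ℕ.* τ0) → Hash m s) → Stream m → Fin m → ℤ → ℕ
confirmations {m} {s} {τ0} g S k c =
  countFin (5 ℕ.* τ0) (λ a → (τ0 ≤ᵇ toℕ a) ∧ reports (binSketch (g a) S (g a k)) k c)

Output : {m s τ0 : ℕ} → (Fin (5 ℕ.* τ0) → Hash m s) → Stream m → Fin m → ℤ → Set
Output {m} {s} {τ0} g S k c =
  inA {τ0 = τ0} g S k c × 4 ℕ.* τ0 ℕ.≤ 2 ℕ.* confirmations {τ0 = τ0} g S k c

Correct : {m s τ0 : ℕ} → (Fin (5 ℕ.* τ0) → Hash m s) → Stream m → Set
Correct {m} {s} {τ0} g S =
  ∀ (k : Fin m) (c : ℤ) →
    (Output {τ0 = τ0} g S k c → (C S k ≢ + 0 × c ≡ C S k)) ×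
    ((C S k ≢ + 0 × c ≡ C S k) → Output {τ0 = τ0} g S k c)

module Submission where

-- Probabilities are counts: the 5τ0 arrays are chosen by a seed vector
-- v ∈ (Fin N)^{5τ0} indexing the hash family, and the theorem lists the good
-- seeds and bounds the number of bad ones.

open import Defs
open import Data.Nat as ℕ using (ℕ)
open import Data.Rational as ℚ using (ℚ; 0ℚ; 1ℚ)
import Data.Rational.Properties as ℚP
open import Data.Fin using (Fin)
open import Data.Vec using (Vec; lookup)
open import Data.List using (List; length)
open import Data.List.Relation.Unary.All using (All)
open import Data.List.Relation.Unary.Unique.Propositional using (Unique)
open import Data.Product using (_×_; ∃-syntax)

open import Data.Nat using (zero; suc; _+_; _*_; _^_; _≤_; _<_; _≤ᵇ_; z≤n; s≤s; NonZero)
open import Data.Nat.Properties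
open import Data.Nat.Tactic.RingSolver using (solve-∀)
open import Data.Fin as Fin using (toℕ)
import Data.Fin.Properties as FinP
open import Data.Vec as Vec using ([]; _∷_; _++_)
open import Data.List as List using ([]; _∷_)
import Data.List.Properties as ListP
open import Data.List.Membership.Propositional using (_∈_)
open import Data.List.Membership.Propositional.Properties using (∈-map⁻; ∈-++⁻)
import Data.List.Relation.Unary.All as All
open import Data.List.Relation.Unary.AllPairs using ([]; _∷_)
open import Data.List.Relation.Unary.Unique.Propositional.Properties using (map⁺; ++⁺)
open import Data.Bool using (Bool; true; false; _∧_; _∨_; not; if_then_else_; T)
open import Function.Bundles using (Equivalence)
open import Data.Bool.Properties
  using (∧-conicalˡ; ∧-conicalʳ; ∧-identityʳ; ∧-zeroʳ; ∨-zeroʳ; ∨-conicalˡ; ∨-conicalʳ; not-involutive; T-≡)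
import Data.Vec.Properties as VecP
open import Data.Product using (_,_; proj₁; proj₂)
open import Function using (_∘_)
open import Relation.Binary.PropositionalEquality
  using (_≡_; _≢_; refl; sym; trans; cong; cong₂; subst; subst₂; module ≡-Reasoning)
open import Algebra.Properties.Semiring.Sum +-*-semiring
  using (sum; sum-syntax; sum-cong-≗; ∑-distrib-+; ∑-comm; *-distribˡ-sum; *-distribʳ-sum)
open import Algebra.Properties.CommutativeSemigroup +-commutativeSemigroup
  using () renaming (interchange to +-interchange)
open import Algebra.Bundles using (Monoid)
open import Data.Integer as ℤ using (ℤ; 0ℤ)
import Data.Integer.Properties as ℤP
open import Data.Integer.Solver using (module +-*-Solver)
open import Data.Sum using (inj₁; inj₂)
open import Data.Empty using (⊥; ⊥-elim)
open import Relation.Nullary using (¬_; does; yes; no; Dec)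
open import Relation.Nullary.Decidable using (dec-true; dec-false; ¬?; _×-dec_; decidable-stable)
import Algebra.Properties.Monoid.Sum as MonoidSum
import Algebra.Properties.CommutativeMonoid.Sum as CommutativeMonoidSum


𝟙 : Bool → ℕ
𝟙 b = if b then 1 else 0

𝟙-∧ : ∀ a b → 𝟙 (a ∧ b) ≡ 𝟙 a * 𝟙 b
𝟙-∧ true  b = sym (+-identityʳ (𝟙 b))
𝟙-∧ false b = refl

𝟙-∨ : ∀ a b → 𝟙 (a ∨ b) ≤ 𝟙 a + 𝟙 b
𝟙-∨ true  b = s≤s z≤n
𝟙-∨ false b = ≤-refl

𝟙-not : ∀ b → 𝟙 b + 𝟙 (not b) ≡ 1
𝟙-not true  = refl
𝟙-not false = refl

𝟙-mono : ∀ {a b} → (a ≡ true → b ≡ true) → 𝟙 a ≤ 𝟙 b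
𝟙-mono {true}  a⇒b rewrite a⇒b refl = ≤-refl
𝟙-mono {false} a⇒b = z≤n

countFin≡∑ : ∀ n (p : Fin n → Bool) → countFin n p ≡ ∑[ i < n ] 𝟙 (p i)
countFin≡∑ zero    p = refl
countFin≡∑ (suc n) p = cong (𝟙 (p Fin.zero) +_) (countFin≡∑ n (p ∘ Fin.suc))

sum-mono : ∀ {n} {f g : Fin n → ℕ} → (∀ i → f i ≤ g i) → sum f ≤ sum g
sum-mono {zero}  f≤g = z≤n
sum-mono {suc n} f≤g = +-mono-≤ (f≤g Fin.zero) (sum-mono (f≤g ∘ Fin.suc))

sum-const : ∀ n c → ∑[ i < n ] c ≡ n * c
sum-const zero    c = refl
sum-const (suc n) c = cong (c +_) (sum-const n c)

term≤sum : ∀ {n} (f : Fin n → ℕ) i → f i ≤ sum f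
term≤sum f Fin.zero    = m≤m+n _ _
term≤sum f (Fin.suc i) = ≤-trans (term≤sum (f ∘ Fin.suc) i) (m≤n+m _ _)

sum-*ˡ : ∀ {n} c (f : Fin n → ℕ) → ∑[ i < n ] (c * f i) ≡ c * sum f
sum-*ˡ c f = sym (*-distribˡ-sum c f)

sum-*ʳ : ∀ {n} c (f : Fin n → ℕ) → ∑[ i < n ] (f i * c) ≡ sum f * c
sum-*ʳ c f = sym (*-distribʳ-sum c f)

module _ {c ℓ} (M : Monoid c ℓ) where
  open Monoid M using (Carrier; _≈_; _∙_; ε; setoid; ∙-cong; ∙-congˡ; identityˡ; identityʳ)
    renaming (trans to ≈-trans)
  open MonoidSum M using (sum-cong-≋; sum-replicate-zero) renaming (sum to ∑)
  open import Relation.Binary.Reasoning.Setoid setoid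

  ∑-zero : ∀ {n} (f : Fin n → Carrier) → (∀ i → f i ≈ ε) → ∑ f ≈ ε
  ∑-zero {n} f f≈ε = ≈-trans (sum-cong-≋ f≈ε) (sum-replicate-zero n)

  ∑-point : ∀ {n} (f : Fin n → Carrier) i → (∀ j → j ≢ i → f j ≈ ε) → ∑ f ≈ f i
  ∑-point f Fin.zero others = begin
    f Fin.zero ∙ ∑ (f ∘ Fin.suc) ≈⟨ ∙-congˡ (∑-zero (f ∘ Fin.suc) (λ j → others (Fin.suc j) λ ())) ⟩
    f Fin.zero ∙ ε               ≈⟨ identityʳ _ ⟩
    f Fin.zero                   ∎
  ∑-point f (Fin.suc i) others = begin
    f Fin.zero ∙ ∑ (f ∘ Fin.suc) ≈⟨ ∙-cong (others Fin.zero λ ()) (∑-point (f ∘ Fin.suc) i restOff) ⟩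
    ε ∙ f (Fin.suc i)            ≈⟨ identityˡ _ ⟩
    f (Fin.suc i)                ∎
    where
    restOff : ∀ j → j ≢ i → f (Fin.suc j) ≈ ε
    restOff j j≢i = others (Fin.suc j) (j≢i ∘ FinP.suc-injective)

anyᶠ : (n : ℕ) → (Fin n → Bool) → Bool
anyᶠ zero    p = false
anyᶠ (suc n) p = p Fin.zero ∨ anyᶠ n (p ∘ Fin.suc)

allᶠ : (n : ℕ) → (Fin n → Bool) → Bool
allᶠ zero    p = true
allᶠ (suc n) p = p Fin.zero ∧ allᶠ n (p ∘ Fin.suc)

anyᶠ-false : ∀ n p → anyᶠ n p ≡ false → ∀ i → p i ≡ false
anyᶠ-false (suc n) p none i with p Fin.zero in p₀
anyᶠ-false (suc n) p none Fin.zero    | false = p₀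
anyᶠ-false (suc n) p none (Fin.suc i) | false = anyᶠ-false n (p ∘ Fin.suc) none i

allᶠ-false : ∀ n p → allᶠ n p ≡ false → ∃[ i ] p i ≡ false
allᶠ-false (suc n) p notAll with p Fin.zero in p₀
... | false = Fin.zero , p₀
... | true  = let (i , pᵢ) = allᶠ-false n (p ∘ Fin.suc) notAll in Fin.suc i , pᵢ

𝟙-anyᶠ : ∀ n p → 𝟙 (anyᶠ n p) ≤ ∑[ i < n ] 𝟙 (p i)
𝟙-anyᶠ zero    p = z≤n
𝟙-anyᶠ (suc n) p = ≤-trans (𝟙-∨ (p Fin.zero) _) (+-monoʳ-≤ (𝟙 (p Fin.zero)) (𝟙-anyᶠ n (p ∘ Fin.suc)))

≤ᵇ-suc : ∀ t x → (suc t ≤ᵇ suc x) ≡ (t ≤ᵇ x)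
≤ᵇ-suc zero    x = refl
≤ᵇ-suc (suc t) x = refl

countFin-cong : ∀ n {p q : Fin n → Bool} → (∀ i → p i ≡ q i) → countFin n p ≡ countFin n q
countFin-cong zero    p≡q = refl
countFin-cong (suc n) p≡q = cong₂ _+_ (cong 𝟙 (p≡q Fin.zero)) (countFin-cong n (p≡q ∘ Fin.suc))

countFin-mono : ∀ n {p q : Fin n → Bool} → (∀ i → p i ≡ true → q i ≡ true) → countFin n p ≤ countFin n q
countFin-mono zero    p⇒q = z≤n
countFin-mono (suc n) p⇒q = +-mono-≤ (𝟙-mono (p⇒q Fin.zero)) (countFin-mono n (p⇒q ∘ Fin.suc))

countFin-cover : ∀ n {p q : Fin n → Bool} → (∀ i → p i ∨ q i ≡ true) → n ≤ countFin n p + countFin n q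
countFin-cover zero    cover = z≤n
countFin-cover (suc n) {p} {q} cover = begin
  suc n
    ≤⟨ +-mono-≤ (one p₀ q₀ (cover Fin.zero)) (countFin-cover n (cover ∘ Fin.suc)) ⟩
  (𝟙 p₀ + 𝟙 q₀) + (countFin n p′ + countFin n q′)
    ≡⟨ +-interchange (𝟙 p₀) (𝟙 q₀) _ _ ⟩
  (𝟙 p₀ + countFin n p′) + (𝟙 q₀ + countFin n q′) ∎
  where
  open ≤-Reasoning
  p₀ = p Fin.zero
  q₀ = q Fin.zero
  p′ = p ∘ Fin.suc
  q′ = q ∘ Fin.suc
  one : ∀ a b → a ∨ b ≡ true → 1 ≤ 𝟙 a + 𝟙 b
  one true  b    _ = s≤s z≤n
  one false true _ = s≤s z≤n

count-≤1 : ∀ n (p : Fin n → Bool) → (∀ i j → p i ≡ true → p j ≡ true → i ≡ j) → ∑[ i < n ] 𝟙 (p i) ≤ 1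
count-≤1 zero    p unique = z≤n
count-≤1 (suc n) p unique with p Fin.zero in p₀
... | true  = s≤s (≤-reflexive (∑-zero +-0-monoid (𝟙 ∘ p ∘ Fin.suc) nowhereElse))
  where
  nowhereElse : ∀ i → 𝟙 (p (Fin.suc i)) ≡ 0
  nowhereElse i with p (Fin.suc i) in pᵢ
  ... | false = refl
  ... | true with () ← unique Fin.zero (Fin.suc i) p₀ pᵢ
... | false = count-≤1 n (p ∘ Fin.suc) (λ i j pᵢ pⱼ → FinP.suc-injective (unique (Fin.suc i) (Fin.suc j) pᵢ pⱼ))

-- A seed vector of length n picks one of the N members of the hash family
-- for each of n arrays; ∑ᵛ n f sums f over all Nⁿ of them, so ∑ᵛ n (𝟙 ∘ E)
-- is Nⁿ times the probability of the event E.
module SeedSums (N : ℕ) where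

  Seeds : ℕ → Set
  Seeds n = Vec (Fin N) n

  ∑ᵛ : (n : ℕ) → (Seeds n → ℕ) → ℕ
  ∑ᵛ zero    f = f []
  ∑ᵛ (suc n) f = ∑[ i < N ] ∑ᵛ n (λ v → f (i ∷ v))

  ∑ᵛ-cong : ∀ n {f g : Seeds n → ℕ} → (∀ v → f v ≡ g v) → ∑ᵛ n f ≡ ∑ᵛ n g
  ∑ᵛ-cong zero    f≡g = f≡g []
  ∑ᵛ-cong (suc n) f≡g = sum-cong-≗ (λ i → ∑ᵛ-cong n (λ v → f≡g (i ∷ v)))

  ∑ᵛ-mono : ∀ n {f g : Seeds n → ℕ} → (∀ v → f v ≤ g v) → ∑ᵛ n f ≤ ∑ᵛ n g
  ∑ᵛ-mono zero    f≤g = f≤g []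
  ∑ᵛ-mono (suc n) f≤g = sum-mono (λ i → ∑ᵛ-mono n (λ v → f≤g (i ∷ v)))

  ∑ᵛ-+ : ∀ n (f g : Seeds n → ℕ) → ∑ᵛ n (λ v → f v + g v) ≡ ∑ᵛ n f + ∑ᵛ n g
  ∑ᵛ-+ zero    f g = refl
  ∑ᵛ-+ (suc n) f g = trans (sum-cong-≗ (λ i → ∑ᵛ-+ n (f ∘ (i ∷_)) (g ∘ (i ∷_))))
    (∑-distrib-+ (λ i → ∑ᵛ n (f ∘ (i ∷_))) (λ i → ∑ᵛ n (g ∘ (i ∷_))))

  ∑ᵛ-*ˡ : ∀ n c (f : Seeds n → ℕ) → ∑ᵛ n (λ v → c * f v) ≡ c * ∑ᵛ n f
  ∑ᵛ-*ˡ zero    c f = refl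
  ∑ᵛ-*ˡ (suc n) c f = trans (sum-cong-≗ (λ i → ∑ᵛ-*ˡ n c (f ∘ (i ∷_)))) (sum-*ˡ c (λ i → ∑ᵛ n (f ∘ (i ∷_))))

  ∑ᵛ-*ʳ : ∀ n c (f : Seeds n → ℕ) → ∑ᵛ n (λ v → f v * c) ≡ ∑ᵛ n f * c
  ∑ᵛ-*ʳ n c f = trans (∑ᵛ-cong n (λ v → *-comm (f v) c)) (trans (∑ᵛ-*ˡ n c f) (*-comm c _))

  ∑ᵛ-const : ∀ n c → ∑ᵛ n (λ _ → c) ≡ N ^ n * c
  ∑ᵛ-const zero    c = sym (+-identityʳ c)
  ∑ᵛ-const (suc n) c = begin
    ∑[ i < N ] ∑ᵛ n (λ _ → c) ≡⟨ sum-cong-≗ {N} (λ _ → ∑ᵛ-const n c) ⟩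
    ∑[ i < N ] (N ^ n * c)     ≡⟨ sum-const N (N ^ n * c) ⟩
    N * (N ^ n * c)           ≡⟨ *-assoc N (N ^ n) c ⟨
    N ^ suc n * c             ∎
    where open ≡-Reasoning

  ∑ᵛ-complement : ∀ n (p : Seeds n → Bool) → ∑ᵛ n (𝟙 ∘ not ∘ p) + ∑ᵛ n (𝟙 ∘ p) ≡ N ^ n
  ∑ᵛ-complement n p = begin
    ∑ᵛ n (𝟙 ∘ not ∘ p) + ∑ᵛ n (𝟙 ∘ p)    ≡⟨ ∑ᵛ-+ n (𝟙 ∘ not ∘ p) (𝟙 ∘ p) ⟨
    ∑ᵛ n (λ v → 𝟙 (not (p v)) + 𝟙 (p v)) ≡⟨ ∑ᵛ-cong n (λ v → trans (+-comm (𝟙 (not (p v))) _) (𝟙-not (p v))) ⟩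
    ∑ᵛ n (λ _ → 1)                       ≡⟨ ∑ᵛ-const n 1 ⟩
    N ^ n * 1                            ≡⟨ *-identityʳ (N ^ n) ⟩
    N ^ n                                ∎
    where open ≡-Reasoning

  ∑ᵛ-comm : ∀ n k (f : Seeds n → Fin k → ℕ) →
    ∑ᵛ n (λ v → ∑[ j < k ] f v j) ≡ ∑[ j < k ] ∑ᵛ n (λ v → f v j)
  ∑ᵛ-comm zero    k f = refl
  ∑ᵛ-comm (suc n) k f = trans (sum-cong-≗ (λ i → ∑ᵛ-comm n k (f ∘ (i ∷_))))
    (∑-comm (λ i j → ∑ᵛ n (λ v → f (i ∷ v) j)))

  ∑ᵛ-++ : ∀ n₁ n₂ (f : Seeds (n₁ + n₂) → ℕ) →
    ∑ᵛ (n₁ + n₂) f ≡ ∑ᵛ n₁ (λ u → ∑ᵛ n₂ (λ w → f (u ++ w)))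
  ∑ᵛ-++ zero     n₂ f = refl
  ∑ᵛ-++ (suc n₁) n₂ f = sum-cong-≗ (λ i → ∑ᵛ-++ n₁ n₂ (f ∘ (i ∷_)))

  ∑ᵛ-allᶠ : ∀ n (q : Fin N → Bool) →
    ∑ᵛ n (λ u → 𝟙 (allᶠ n (q ∘ lookup u))) ≡ (∑[ i < N ] 𝟙 (q i)) ^ n
  ∑ᵛ-allᶠ zero    q = refl
  ∑ᵛ-allᶠ (suc n) q = begin
    ∑[ i < N ] ∑ᵛ n (λ u → 𝟙 (q i ∧ allᶠ n (q ∘ lookup u)))
      ≡⟨ sum-cong-≗ (λ i → ∑ᵛ-cong n (λ u → 𝟙-∧ (q i) (allᶠ n (q ∘ lookup u)))) ⟩
    ∑[ i < N ] ∑ᵛ n (λ u → 𝟙 (q i) * 𝟙 (allᶠ n (q ∘ lookup u)))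
      ≡⟨ sum-cong-≗ (λ i → trans (∑ᵛ-*ˡ n (𝟙 (q i)) (λ u → 𝟙 (allᶠ n (q ∘ lookup u))))
                                 (cong (𝟙 (q i) *_) (∑ᵛ-allᶠ n q))) ⟩
    ∑[ i < N ] (𝟙 (q i) * P ^ n)
      ≡⟨ sum-*ʳ (P ^ n) (𝟙 ∘ q) ⟩
    P * P ^ n ∎
    where
    open ≡-Reasoning
    P = ∑[ i < N ] 𝟙 (q i)

-- Strict Bin Sketches

does-true : ∀ {A : Set} (d : Dec A) → does d ≡ true → A
does-true (yes a) _ = a

if-does-false : ∀ {A : Set} (d : Dec A) → (if does d then false else true) ≡ true → ¬ A
if-does-false (no ¬a) _ = ¬a

*-≢0 : ∀ a b → a ≢ 0ℤ → b ≢ 0ℤ → a ℤ.* b ≢ 0ℤ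
*-≢0 a b a≢0 b≢0 ab≡0 with ℤP.i*j≡0⇒i≡0∨j≡0 a ab≡0
... | inj₁ a≡0 = a≢0 a≡0
... | inj₂ b≡0 = b≢0 b≡0

open CommutativeMonoidSum ℤP.+-0-commutativeMonoid using ()
  renaming (sum to ∑ᶻ; sum-cong-≗ to ∑ᶻ-cong; ∑-distrib-+ to ∑ᶻ-distrib-+)

module Sketches {m : ℕ} where
  open import Data.Integer using (+_)

  isElem : Stream m → Fin m → Bool
  isElem S y = if does (C S y ℤ.≟ + 0) then false else true

  isElem-true : ∀ S y → C S y ≢ + 0 → isElem S y ≡ true
  isElem-true S y C≢0 rewrite dec-false (C S y ℤ.≟ + 0) C≢0 = refl

  isElem-false : ∀ S y → isElem S y ≡ false → C S y ≡ + 0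
  isElem-false S y notElem with C S y ℤ.≟ + 0
  ... | yes C≡0 = C≡0

  inBin : {s : ℕ} → Hash m s → Fin s → Fin m → Bool
  inBin h b y = does (h y Fin.≟ b)

  binTotal : {s : ℕ} → (Fin m → ℤ) → Hash m s → Stream m → Fin s → ℤ
  binTotal wt h S b = ∑ᶻ (λ y → if inBin h b y then C S y ℤ.* wt y else + 0)

  binTotal-∷ : ∀ {s} wt (h : Hash m s) b x c S →
    binTotal wt h ((x , c) ∷ S) b ≡ (if inBin h b x then c ℤ.* wt x else + 0) ℤ.+ binTotal wt h S b
  binTotal-∷ wt h b x c S = begin
    ∑ᶻ (λ y → if inBin h b y then C ((x , c) ∷ S) y ℤ.* wt y else + 0)
      ≡⟨ ∑ᶻ-cong split ⟩
    ∑ᶻ (λ y → new y ℤ.+ old y)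
      ≡⟨ ∑ᶻ-distrib-+ new old ⟩
    ∑ᶻ new ℤ.+ ∑ᶻ old
      ≡⟨ cong (ℤ._+ ∑ᶻ old) (trans (∑-point ℤP.+-0-monoid new x onlyAtx) atx) ⟩
    term ℤ.+ ∑ᶻ old ∎
    where
    open ≡-Reasoning
    term = if inBin h b x then c ℤ.* wt x else + 0
    new old : Fin _ → ℤ
    new y = if does (x Fin.≟ y) then term else + 0
    old y = if inBin h b y then C S y ℤ.* wt y else + 0
    split : ∀ y → (if inBin h b y then C ((x , c) ∷ S) y ℤ.* wt y else + 0) ≡ new y ℤ.+ old y
    split y with x Fin.≟ y
    split y | no _ = sym (ℤP.+-identityˡ (old y))
    split y | yes refl with inBin h b x
    ... | true  = ℤP.*-distribʳ-+ (wt x) c (C S x)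
    ... | false = refl
    onlyAtx : ∀ y → y ≢ x → new y ≡ + 0
    onlyAtx y y≢x rewrite dec-false (x Fin.≟ y) (y≢x ∘ sym) = refl
    atx : new x ≡ term
    atx rewrite dec-true (x Fin.≟ x) refl = refl

  binTotal-[] : ∀ {s} wt (h : Hash m s) b → binTotal wt h [] b ≡ + 0
  binTotal-[] wt h b = ∑-zero ℤP.+-0-monoid _ empty
    where
    empty : ∀ y → (if inBin h b y then + 0 ℤ.* wt y else + 0) ≡ + 0
    empty y with inBin h b y
    ... | true  = refl
    ... | false = refl

  sk-cong : ∀ {X X′ Y Y′ Z Z′} → X ≡ X′ → Y ≡ Y′ → Z ≡ Z′ → sk X Y Z ≡ sk X′ Y′ Z′
  sk-cong refl refl refl = refl

  key² : Fin m → ℤ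
  key² y = keyℤ y ℤ.* keyℤ y

  binSketch≡totals : ∀ {s} (h : Hash m s) S b →
    binSketch h S b ≡ sk (binTotal (λ _ → + 1) h S b) (binTotal keyℤ h S b) (binTotal key² h S b)
  binSketch≡totals h [] b =
    sk-cong (sym (binTotal-[] (λ _ → + 1) h b)) (sym (binTotal-[] keyℤ h b)) (sym (binTotal-[] key² h b))
  binSketch≡totals h ((x , c) ∷ S) b
    rewrite binTotal-∷ (λ _ → + 1) h b x c S | binTotal-∷ keyℤ h b x c S | binTotal-∷ key² h b x c S
    with h x Fin.≟ b | binSketch≡totals h S b
  ... | yes _ | IH = sk-cong (cong₂ ℤ._+_ (sym (ℤP.*-identityʳ c)) (cong Sketch.X IH))
                             (cong (λ z → c ℤ.* keyℤ x ℤ.+ z) (cong Sketch.Y IH))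
                             (cong₂ ℤ._+_ (ℤP.*-assoc c (keyℤ x) (keyℤ x)) (cong Sketch.Z IH))
  ... | no  _ | IH = trans IH (sk-cong (sym (ℤP.+-identityˡ _)) (sym (ℤP.+-identityˡ _)) (sym (ℤP.+-identityˡ _)))

  otherElem : Stream m → Fin m → Fin m → Bool
  otherElem S x y = isElem S y ∧ not (does (y Fin.≟ x))

  collides : {s : ℕ} → Stream m → Hash m s → Fin m → Bool
  collides S h x = anyᶠ m (λ y → otherElem S x y ∧ inBin h (h x) y)

  binTotal-clean : ∀ {s} wt (h : Hash m s) S x → collides S h x ≡ false →
    binTotal wt h S (h x) ≡ C S x ℤ.* wt x
  binTotal-clean wt h S x clean = trans (∑-point ℤP.+-0-monoid _ x others) atx
    where
    others : ∀ y → y ≢ x → (if inBin h (h x) y then C S y ℤ.* wt y else + 0) ≡ + 0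
    others y y≢x with inBin h (h x) y | anyᶠ-false m _ clean y
    ... | false | _ = refl
    ... | true  | notColliding rewrite dec-false (y Fin.≟ x) y≢x =
      cong (ℤ._* wt y) (isElem-false S y (trans (sym (∧-identityʳ (isElem S y))) (trans (sym (∧-identityʳ _)) notColliding)))
    atx : (if inBin h (h x) x then C S x ℤ.* wt x else + 0) ≡ C S x ℤ.* wt x
    atx rewrite dec-true (h x Fin.≟ h x) refl = refl

  pointSketch : Fin m → ℤ → Sketch
  pointSketch k a = sk a (a ℤ.* keyℤ k) (a ℤ.* key² k)

  cleanBin : ∀ {s} (h : Hash m s) S k → collides S h k ≡ false → binSketch h S (h k) ≡ pointSketch k (C S k)
  cleanBin h S k clean = trans (binSketch≡totals h S (h k))
    (sk-cong (trans (binTotal-clean _ h S k clean) (ℤP.*-identityʳ (C S k)))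
             (binTotal-clean keyℤ h S k clean)
             (binTotal-clean key² h S k clean))

  key≢0 : (k : Fin m) → keyℤ k ≢ + 0
  key≢0 k ()

  pointSketch-XZ≡Y² : ∀ k a → a ℤ.* (a ℤ.* key² k) ≡ a ℤ.* keyℤ k ℤ.* (a ℤ.* keyℤ k)
  pointSketch-XZ≡Y² k a = solve 2 (λ a x → a :* (a :* (x :* x)) := a :* x :* (a :* x)) refl a (keyℤ k)
    where open +-*-Solver

  pointSketch-reports : ∀ k a → a ≢ + 0 → reports (pointSketch k a) k a ≡ true
  pointSketch-reports k a a≢0
    rewrite dec-false (a ℤ.≟ + 0) a≢0
          | dec-false (a ℤ.* keyℤ k ℤ.≟ + 0) (*-≢0 a _ a≢0 (key≢0 k))
          | dec-false (a ℤ.* key² k ℤ.≟ + 0) (*-≢0 a _ a≢0 (*-≢0 _ _ (key≢0 k) (key≢0 k)))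
          | dec-true (a ℤ.* (a ℤ.* key² k) ℤ.≟ a ℤ.* keyℤ k ℤ.* (a ℤ.* keyℤ k)) (pointSketch-XZ≡Y² k a)
          | dec-true (a ℤ.≟ a) refl
          | dec-true (a ℤ.* keyℤ k ℤ.≟ keyℤ k ℤ.* a) (ℤP.*-comm a (keyℤ k)) = refl

  pointSketch-reports-only : ∀ k a c → reports (pointSketch k a) k c ≡ true → a ≢ + 0 × c ≡ a
  pointSketch-reports-only k a c reported =
    if-does-false (a ℤ.≟ + 0) (∧-conicalˡ _ _ passed) , sym (does-true (a ℤ.≟ c) (∧-conicalˡ _ _ countMatches))
    where
    t = pointSketch k a
    passed = ∧-conicalˡ (passes t) _ reported
    countMatches = ∧-conicalʳ (passes t) (does (a ℤ.≟ c) ∧ _) reported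

  cleanBin-reports : ∀ {s} (h : Hash m s) S k → collides S h k ≡ false → C S k ≢ + 0 →
    reports (binSketch h S (h k)) k (C S k) ≡ true
  cleanBin-reports h S k clean C≢0 =
    subst (λ t → reports t k (C S k) ≡ true) (sym (cleanBin h S k clean)) (pointSketch-reports k (C S k) C≢0)

  cleanBin-reports-only : ∀ {s} (h : Hash m s) S k c → collides S h k ≡ false →
    reports (binSketch h S (h k)) k c ≡ true → C S k ≢ + 0 × c ≡ C S k
  cleanBin-reports-only h S k c clean reported =
    pointSketch-reports-only k (C S k) c (subst (λ t → reports t k c ≡ true) (cleanBin h S k clean) reported)

  claims : Sketch → Fin m → Bool
  claims t k = passes t ∧ does (Sketch.Y t ℤ.≟ keyℤ k ℤ.* Sketch.X t)

  reports⇒claims : ∀ t k c → reports t k c ≡ true → claims t k ≡ true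
  reports⇒claims t k c reported = cong₂ _∧_ passed YisKX
    where
    passed = ∧-conicalˡ (passes t) _ reported
    YisKX = ∧-conicalʳ (does (Sketch.X t ℤ.≟ c)) _ (∧-conicalʳ (passes t) _ reported)

  passes⇒X≢0 : ∀ t → passes t ≡ true → Sketch.X t ≢ + 0
  passes⇒X≢0 t passed = if-does-false (Sketch.X t ℤ.≟ + 0) (∧-conicalˡ _ _ passed)

  keyℤ-injective : (k k′ : Fin m) → keyℤ k ≡ keyℤ k′ → k ≡ k′
  keyℤ-injective k k′ eq = FinP.toℕ-injective (suc-injective (ℤP.+-injective eq))

  claims-unique : ∀ t → ∑[ k < m ] 𝟙 (claims t k) ≤ 𝟙 (passes t)
  claims-unique t with passes t in passed
  ... | false = ≤-reflexive (∑-zero +-0-monoid {m} (λ _ → 0) (λ _ → refl))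
  ... | true  = count-≤1 m _ sameKey
    where
    X = Sketch.X t
    Y = Sketch.Y t
    sameKey : ∀ i j → does (Y ℤ.≟ keyℤ i ℤ.* X) ≡ true → does (Y ℤ.≟ keyℤ j ℤ.* X) ≡ true → i ≡ j
    sameKey i j claimsI claimsJ = keyℤ-injective i j
      (ℤP.*-cancelʳ-≡ (keyℤ i) (keyℤ j) X {{ℤ.≢-nonZero (passes⇒X≢0 t passed)}}
        (trans (sym (does-true (Y ℤ.≟ _) claimsI)) (does-true (Y ℤ.≟ _) claimsJ)))

  passes⇒occupied : ∀ {s} (h : Hash m s) S b →
    𝟙 (passes (binSketch h S b)) ≤ ∑[ y < m ] 𝟙 (isElem S y ∧ inBin h b y)
  passes⇒occupied h S b with passes (binSketch h S b) in passed
  ... | false = z≤n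
  ... | true  = ≤-trans (≤-reflexive (sym (occupied y (proj₂ witness)))) (term≤sum _ y)
    where
    term : Fin m → ℤ
    term y = if inBin h b y then C S y ℤ.* + 1 else + 0
    X≢0 : binTotal (λ _ → + 1) h S b ≢ + 0
    X≢0 X≡0 = passes⇒X≢0 (binSketch h S b) passed (trans (cong Sketch.X (binSketch≡totals h S b)) X≡0)
    witness = FinP.¬∀⟶∃¬ m _ (λ y → term y ℤ.≟ + 0) (λ allZero → X≢0 (∑-zero ℤP.+-0-monoid term allZero))
    y = proj₁ witness
    occupied : ∀ y → term y ≢ + 0 → 𝟙 (isElem S y ∧ inBin h b y) ≡ 1
    occupied y term≢0 with inBin h b y
    ... | false = ⊥-elim (term≢0 refl)
    ... | true rewrite isElem-true S y (λ C≡0 → term≢0 (trans (ℤP.*-identityʳ _) C≡0)) = refl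

  passingBins≤elements : ∀ {s} (h : Hash m s) S → ∑[ b < s ] 𝟙 (passes (binSketch h S b)) ≤ numElements S
  passingBins≤elements {s} h S = begin
    ∑[ b < s ] 𝟙 (passes (binSketch h S b))            ≤⟨ sum-mono (passes⇒occupied h S) ⟩
    ∑[ b < s ] ∑[ y < m ] 𝟙 (isElem S y ∧ inBin h b y) ≡⟨ ∑-comm (λ b y → 𝟙 (isElem S y ∧ inBin h b y)) ⟩
    ∑[ y < m ] ∑[ b < s ] 𝟙 (isElem S y ∧ inBin h b y) ≡⟨ sum-cong-≗ (λ y → ∑-point +-0-monoid _ (h y) (otherBin y)) ⟩
    ∑[ y < m ] 𝟙 (isElem S y ∧ inBin h (h y) y)        ≡⟨ sum-cong-≗ ownBin ⟩
    ∑[ y < m ] 𝟙 (isElem S y)                          ≡⟨ countFin≡∑ m (isElem S) ⟨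
    numElements S                                      ∎
    where
    open ≤-Reasoning
    otherBin : ∀ y b → b ≢ h y → 𝟙 (isElem S y ∧ inBin h b y) ≡ 0
    otherBin y b b≢hy rewrite dec-false (h y Fin.≟ b) (b≢hy ∘ sym) = cong 𝟙 (∧-zeroʳ (isElem S y))
    ownBin : ∀ y → 𝟙 (isElem S y ∧ inBin h (h y) y) ≡ 𝟙 (isElem S y)
    ownBin y rewrite dec-true (h y Fin.≟ h y) refl = cong 𝟙 (∧-identityʳ (isElem S y))

-- Collisions under a pairwise independent family

-- Counting over the N members of the family: two distinct keys share a bin
-- with probability 1/s, so by the union bound a fixed key collides with
-- probability at most #elements / s.
module Collisions {m N s : ℕ} .{{_ : NonZero s}} (S : Stream m) (H : Fin N → Hash m s)
                  (pairwise : PairwiseIndependent H) where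
  open Sketches {m}

  sameBin-count : ∀ x y → y ≢ x → (∑[ i < N ] 𝟙 (inBin (H i) (H i x) y)) * s ≡ N
  sameBin-count x y y≢x = *-cancelʳ-≡ _ N s (begin
    P * s * s                      ≡⟨ *-assoc P s s ⟩
    P * (s * s)                    ≡⟨ cong (_* (s * s)) P≡∑joint ⟩
    (∑[ b < s ] joint b) * (s * s) ≡⟨ sum-*ʳ (s * s) joint ⟨
    ∑[ b < s ] (joint b * (s * s)) ≡⟨ sum-cong-≗ (λ b → proj₂ pairwise x y (y≢x ∘ sym) b b) ⟩
    ∑[ b < s ] N                   ≡⟨ sum-const s N ⟩
    s * N                          ≡⟨ *-comm s N ⟩
    N * s                          ∎)
    where
    open ≡-Reasoning
    P = ∑[ i < N ] 𝟙 (inBin (H i) (H i x) y)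
    bothIn : Fin N → Fin s → Bool
    bothIn i b = does (H i x Fin.≟ b) ∧ does (H i y Fin.≟ b)
    joint : Fin s → ℕ
    joint b = countFin N (λ i → bothIn i b)
    sameBin≡∑ : ∀ i → 𝟙 (inBin (H i) (H i x) y) ≡ ∑[ b < s ] 𝟙 (bothIn i b)
    sameBin≡∑ i = sym (trans (∑-point +-0-monoid (𝟙 ∘ bothIn i) (H i x) otherBins) ownBin)
      where
      otherBins : ∀ b → b ≢ H i x → 𝟙 (bothIn i b) ≡ 0
      otherBins b b≢Hx rewrite dec-false (H i x Fin.≟ b) (b≢Hx ∘ sym) = refl
      ownBin : 𝟙 (bothIn i (H i x)) ≡ 𝟙 (inBin (H i) (H i x) y)
      ownBin rewrite dec-true (H i x Fin.≟ H i x) refl = refl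
    P≡∑joint : P ≡ ∑[ b < s ] joint b
    P≡∑joint = begin
      P                                    ≡⟨ sum-cong-≗ sameBin≡∑ ⟩
      ∑[ i < N ] ∑[ b < s ] 𝟙 (bothIn i b) ≡⟨ ∑-comm (λ i b → 𝟙 (bothIn i b)) ⟩
      ∑[ b < s ] ∑[ i < N ] 𝟙 (bothIn i b) ≡⟨ sum-cong-≗ (λ b → countFin≡∑ N (λ i → bothIn i b)) ⟨
      ∑[ b < s ] joint b                   ∎

  collisionCount : Fin m → ℕ
  collisionCount x = countFin N (λ i → collides S (H i) x)

  collisionCount-bound : ∀ x → collisionCount x * s ≤ numElements S * N
  collisionCount-bound x = begin
    collisionCount x * s
      ≡⟨ cong (_* s) (countFin≡∑ N (λ i → collides S (H i) x)) ⟩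
    (∑[ i < N ] 𝟙 (collides S (H i) x)) * s
      ≤⟨ *-monoˡ-≤ s (sum-mono (λ i → 𝟙-anyᶠ m (λ y → otherElem S x y ∧ shared i y))) ⟩
    (∑[ i < N ] ∑[ y < m ] 𝟙 (otherElem S x y ∧ shared i y)) * s
      ≡⟨ cong (_* s) (∑-comm (λ i y → 𝟙 (otherElem S x y ∧ shared i y))) ⟩
    (∑[ y < m ] ∑[ i < N ] 𝟙 (otherElem S x y ∧ shared i y)) * s
      ≡⟨ cong (_* s) (sum-cong-≗ factor) ⟩
    (∑[ y < m ] (𝟙 (otherElem S x y) * P y)) * s
      ≡⟨ sum-*ʳ s (λ y → 𝟙 (otherElem S x y) * P y) ⟨
    ∑[ y < m ] (𝟙 (otherElem S x y) * P y * s)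
      ≤⟨ sum-mono pairBound ⟩
    ∑[ y < m ] (𝟙 (isElem S y) * N)
      ≡⟨ sum-*ʳ N (𝟙 ∘ isElem S) ⟩
    (∑[ y < m ] 𝟙 (isElem S y)) * N
      ≡⟨ cong (_* N) (countFin≡∑ m (isElem S)) ⟨
    numElements S * N ∎
    where
    open ≤-Reasoning
    shared : Fin N → Fin m → Bool
    shared i y = inBin (H i) (H i x) y
    P : Fin m → ℕ
    P y = ∑[ i < N ] 𝟙 (shared i y)
    factor : ∀ y → ∑[ i < N ] 𝟙 (otherElem S x y ∧ shared i y) ≡ 𝟙 (otherElem S x y) * P y
    factor y = trans (sum-cong-≗ (λ i → 𝟙-∧ (otherElem S x y) (shared i y)))
                     (sum-*ˡ (𝟙 (otherElem S x y)) (λ i → 𝟙 (shared i y)))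
    pairBound : ∀ y → 𝟙 (otherElem S x y) * P y * s ≤ 𝟙 (isElem S y) * N
    pairBound y with y Fin.≟ x
    ... | yes refl rewrite ∧-zeroʳ (isElem S x) = z≤n
    ... | no y≢x rewrite ∧-identityʳ (isElem S y) =
      ≤-reflexive (trans (*-assoc (𝟙 (isElem S y)) (P y) s) (cong (𝟙 (isElem S y) *_) (sameBin-count x y y≢x)))

-- A tail bound for repeated independent trials

-- If one trial hits the event p with probability at most 1/8, then among
-- n independent trials at least t hit p with probability at most 2ⁿ/8ᵗ
-- (the union bound over the at most 2ⁿ sets of t trials), stated here in
-- counting form over the Nⁿ seed vectors.
module TailBound (N : ℕ) (p : Fin N → Bool) (rare : 8 * ∑[ i < N ] 𝟙 (p i) ≤ N) where
  open SeedSums N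

  hits : ∀ {n} → Seeds n → ℕ
  hits {n} w = countFin n (λ a → p (lookup w a))

  atLeast : ℕ → ℕ → ℕ
  atLeast n t = ∑ᵛ n (λ w → 𝟙 (t ≤ᵇ hits w))

  P : ℕ
  P = ∑[ i < N ] 𝟙 (p i)

  -- Condition on the first trial.
  atLeast-step : ∀ n t → atLeast (suc n) (suc t) ≤ P * atLeast n t + N * atLeast n (suc t)
  atLeast-step n t = begin
    ∑[ i < N ] ∑ᵛ n (λ w → 𝟙 (suc t ≤ᵇ 𝟙 (p i) + hits w))
      ≤⟨ sum-mono byFirst ⟩
    ∑[ i < N ] (𝟙 (p i) * atLeast n t + atLeast n (suc t))
      ≡⟨ ∑-distrib-+ (λ i → 𝟙 (p i) * atLeast n t) (λ _ → atLeast n (suc t)) ⟩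
    ∑[ i < N ] (𝟙 (p i) * atLeast n t) + ∑[ i < N ] atLeast n (suc t)
      ≡⟨ cong₂ _+_ (sum-*ʳ (atLeast n t) (𝟙 ∘ p)) (sum-const N (atLeast n (suc t))) ⟩
    P * atLeast n t + N * atLeast n (suc t) ∎
    where
    open ≤-Reasoning
    byFirst : ∀ i → ∑ᵛ n (λ w → 𝟙 (suc t ≤ᵇ 𝟙 (p i) + hits w)) ≤ 𝟙 (p i) * atLeast n t + atLeast n (suc t)
    byFirst i with p i
    ... | true  = ≤-trans (≤-reflexive (trans (∑ᵛ-cong n (λ w → cong 𝟙 (≤ᵇ-suc t (hits w)))) (sym (+-identityʳ _))))
                          (m≤m+n _ _)
    ... | false = ≤-refl

  tail-bound : ∀ n t → atLeast n t * 8 ^ t ≤ 2 ^ n * N ^ n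
  tail-bound zero    zero    = ≤-refl
  tail-bound zero    (suc t) = z≤n
  tail-bound (suc n) zero    = begin
    atLeast (suc n) 0 * 1 ≡⟨ *-identityʳ _ ⟩
    ∑ᵛ (suc n) (λ _ → 1)  ≡⟨ trans (∑ᵛ-const (suc n) 1) (*-identityʳ _) ⟩
    N ^ suc n             ≤⟨ m≤n*m (N ^ suc n) (2 ^ suc n) {{m^n≢0 2 (suc n)}} ⟩
    2 ^ suc n * N ^ suc n ∎
    where open ≤-Reasoning
  tail-bound (suc n) (suc t) = begin
    atLeast (suc n) (suc t) * 8 ^ suc t
      ≤⟨ *-monoˡ-≤ (8 ^ suc t) (atLeast-step n t) ⟩
    (P * atLeast n t + N * atLeast n (suc t)) * (8 * 8 ^ t)
      ≡⟨ regroup P (atLeast n t) N (atLeast n (suc t)) (8 ^ t) ⟩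
    (8 * P) * (atLeast n t * 8 ^ t) + N * (atLeast n (suc t) * 8 ^ suc t)
      ≤⟨ +-mono-≤ (*-mono-≤ rare (tail-bound n t)) (*-monoʳ-≤ N (tail-bound n (suc t))) ⟩
    N * (2 ^ n * N ^ n) + N * (2 ^ n * N ^ n)
      ≡⟨ double N (2 ^ n) (N ^ n) ⟩
    2 ^ suc n * N ^ suc n ∎
    where
    open ≤-Reasoning
    regroup : ∀ c a n b e → (c * a + n * b) * (8 * e) ≡ (8 * c) * (a * e) + n * (b * (8 * e))
    regroup = solve-∀
    double : ∀ n x y → n * (x * y) + n * (x * y) ≡ 2 * x * (n * y)
    double = solve-∀

-- Arrays are indexed by Fin (n₁ + n₂) and chosen by a seed vector u ++ w:
-- the n₁ candidate arrays by u, the n₂ confirmation arrays by w.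
module _ {A : Set} {n₁ n₂ : ℕ} (u : Vec A n₁) (w : Vec A n₂) where

  firstPhase-lookup : ∀ a → (suc (toℕ a) ≤ᵇ n₁) ≡ true → ∃[ a′ ] lookup (u ++ w) a ≡ lookup u a′
  firstPhase-lookup a inFirst = Fin.fromℕ< a<n₁ , VecP.lookup-++-< u w a a<n₁
    where
    a<n₁ : toℕ a < n₁
    a<n₁ = ≤ᵇ⇒≤ (suc (toℕ a)) n₁ (Equivalence.from T-≡ inFirst)

  firstPhase-index : ∀ a′ →
    (suc (toℕ (a′ Fin.↑ˡ n₂)) ≤ᵇ n₁) ≡ true × lookup (u ++ w) (a′ Fin.↑ˡ n₂) ≡ lookup u a′
  firstPhase-index a′ = Equivalence.to T-≡ (≤⇒≤ᵇ a<n₁) , VecP.lookup-++ˡ u w a′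
    where
    a<n₁ : toℕ (a′ Fin.↑ˡ n₂) < n₁
    a<n₁ = subst (_< n₁) (sym (FinP.toℕ-↑ˡ a′ n₂)) (FinP.toℕ<n a′)

  take-drop-++ : Vec.take n₁ (u ++ w) ≡ u × Vec.drop n₁ (u ++ w) ≡ w
  take-drop-++ = VecP.++-injective (Vec.take n₁ (u ++ w)) u (VecP.take++drop≡id n₁ (u ++ w))

secondPhase-count : ∀ {A : Set} (f : A → Bool) {n₁ n₂} (u : Vec A n₁) (w : Vec A n₂) →
  countFin (n₁ + n₂) (λ a → (n₁ ≤ᵇ toℕ a) ∧ f (lookup (u ++ w) a)) ≡ countFin n₂ (f ∘ lookup w)
secondPhase-count f           []      w = refl
secondPhase-count f {suc n₁} (x ∷ u) w = trans
  (countFin-cong (n₁ + _) (λ a → cong (_∧ f (lookup (u ++ w) a)) (≤ᵇ-suc n₁ (toℕ a))))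
  (secondPhase-count f u w)

threshold-reached : ∀ t a b → 4 * t ≤ a + b → b < 2 * t → 4 * t ≤ 2 * a
threshold-reached t a b cover b<2t = ≤-trans (≤-reflexive (*-assoc 2 2 t)) (*-monoʳ-≤ 2 2t≤a)
  where
  2t≤a : 2 * t ≤ a
  2t≤a = +-cancelʳ-≤ (2 * t) (2 * t) a (begin
    2 * t + 2 * t ≡⟨ *-distribʳ-+ t 2 2 ⟨
    4 * t         ≤⟨ cover ⟩
    a + b         ≤⟨ +-monoʳ-≤ a (<⇒≤ b<2t) ⟩
    a + 2 * t     ∎)
    where open ≤-Reasoning

threshold-missed : ∀ t a b → a ≤ b → b < 2 * t → 4 * t ≤ 2 * a → ⊥
threshold-missed t a b a≤b b<2t reached = <-irrefl refl (begin-strict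
  2 * t ≤⟨ *-cancelˡ-≤ 2 (≤-trans (≤-reflexive (sym (*-assoc 2 2 t))) reached) ⟩
  a     ≤⟨ a≤b ⟩
  b     <⟨ b<2t ⟩
  2 * t ∎)
  where open ≤-Reasoning

module Run {m N s : ℕ} (S : Stream m) (H : Fin N → Hash m s) (τ0 : ℕ) where
  open Sketches {m}

  collisions : ∀ {n} → Fin m → Vec (Fin N) n → ℕ
  collisions {n} k w = countFin n (λ a → collides S (H (lookup w a)) k)

  heavy : Fin m → Vec (Fin N) (4 * τ0) → Bool
  heavy k w = 2 * τ0 ≤ᵇ collisions k w

  missed : Vec (Fin N) τ0 → Bool
  missed u = anyᶠ m (λ x → isElem S x ∧ allᶠ τ0 (λ a → collides S (H (lookup u a)) x))

  heavyClaim : Vec (Fin N) τ0 → Vec (Fin N) (4 * τ0) → Bool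
  heavyClaim u w =
    anyᶠ τ0 (λ a → anyᶠ s (λ b → anyᶠ m (λ k → claims (binSketch (H (lookup u a)) S b) k ∧ heavy k w)))

  bad : Vec (Fin N) (5 * τ0) → Bool
  bad v = missed (Vec.take τ0 v) ∨ heavyClaim (Vec.take τ0 v) (Vec.drop τ0 v)

  arrays : Vec (Fin N) τ0 → Vec (Fin N) (4 * τ0) → Fin (5 * τ0) → Hash m s
  arrays u w a = H (lookup (u ++ w) a)

  module _ (u : Vec (Fin N) τ0) (w : Vec (Fin N) (4 * τ0)) (noHeavyClaim : heavyClaim u w ≡ false) where

    reportsAt : Fin m → ℤ → Fin N → Bool
    reportsAt k c i = reports (binSketch (H i) S (H i k)) k c

    confirmations≡ : ∀ k c → confirmations {τ0 = τ0} (arrays u w) S k c ≡ countFin (4 * τ0) (reportsAt k c ∘ lookup w)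
    confirmations≡ k c = secondPhase-count (reportsAt k c) u w

    claimed⇒light : ∀ a b k → claims (binSketch (H (lookup u a)) S b) k ≡ true → collisions k w < 2 * τ0
    claimed⇒light a b k claimed = ≰⇒> (λ isHeavy → subst T notHeavy (≤⇒≤ᵇ isHeavy))
      where
      noClaim = anyᶠ-false m _ (anyᶠ-false s _ (anyᶠ-false τ0 _ noHeavyClaim a) b) k
      notHeavy : heavy k w ≡ false
      notHeavy = trans (sym (cong (_∧ heavy k w) claimed)) noClaim

    complete : missed u ≡ false → ∀ k → C S k ≢ 0ℤ → Output {τ0 = τ0} (arrays u w) S k (C S k)
    complete notMissed k C≢0 = (a′ Fin.↑ˡ (4 * τ0) , H i k , inFirst , reportedAt) , enough
      where
      isolated : ∃[ a ] collides S (H (lookup u a)) k ≡ false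
      isolated = allᶠ-false τ0 _
        (trans (sym (cong (_∧ allᶠ τ0 (λ a → collides S (H (lookup u a)) k)) (isElem-true S k C≢0)))
               (anyᶠ-false m _ notMissed k))
      a′ = proj₁ isolated
      i = lookup u a′
      inFirst = proj₁ (firstPhase-index u w a′)
      candidate : reportsAt k (C S k) i ≡ true
      candidate = cleanBin-reports (H i) S k (proj₂ isolated) C≢0
      reportedAt : reports (binSketch (arrays u w (a′ Fin.↑ˡ (4 * τ0))) S (H i k)) k (C S k) ≡ true
      reportedAt = subst (λ j → reports (binSketch (H j) S (H i k)) k (C S k) ≡ true)
                         (sym (proj₂ (firstPhase-index u w a′))) candidate
      reportsOrCollides : ∀ j → reportsAt k (C S k) (lookup w j) ∨ collides S (H (lookup w j)) k ≡ true
      reportsOrCollides j with collides S (H (lookup w j)) k in clean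
      ... | true  = ∨-zeroʳ _
      ... | false rewrite cleanBin-reports (H (lookup w j)) S k clean C≢0 = refl
      enough : 4 * τ0 ≤ 2 * confirmations {τ0 = τ0} (arrays u w) S k (C S k)
      enough = threshold-reached τ0 _ (collisions k w)
        (subst (λ n → 4 * τ0 ≤ n + collisions k w) (sym (confirmations≡ k (C S k)))
               (countFin-cover (4 * τ0) reportsOrCollides))
        (claimed⇒light a′ (H i k) k (reports⇒claims (binSketch (H i) S (H i k)) k (C S k) candidate))

    -- Soundness: a wrong pair can only be reported where k collides, hence
    -- too rarely to be output.
    rejects : ∀ k c → ¬ (C S k ≢ 0ℤ × c ≡ C S k) → ¬ Output {τ0 = τ0} (arrays u w) S k c
    rejects k c wrong ((a , b , inFirst , reported) , enough) =
      threshold-missed τ0 _ (collisions k w) fewConfirmations (claimed⇒light a′ b k claimed) enough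
      where
      a′ = proj₁ (firstPhase-lookup u w a inFirst)
      claimed : claims (binSketch (H (lookup u a′)) S b) k ≡ true
      claimed = reports⇒claims (binSketch (H (lookup u a′)) S b) k c
        (subst (λ j → reports (binSketch (H j) S b) k c ≡ true) (proj₂ (firstPhase-lookup u w a inFirst)) reported)
      onlyColliding : ∀ j → reportsAt k c (lookup w j) ≡ true → collides S (H (lookup w j)) k ≡ true
      onlyColliding j reportedAtj with collides S (H (lookup w j)) k in clean
      ... | true  = refl
      ... | false = ⊥-elim (wrong (cleanBin-reports-only (H (lookup w j)) S k c clean reportedAtj))
      fewConfirmations : confirmations {τ0 = τ0} (arrays u w) S k c ≤ collisions k w
      fewConfirmations = subst (_≤ collisions k w) (sym (confirmations≡ k c)) (countFin-mono (4 * τ0) onlyColliding)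

    correct : missed u ≡ false → Correct {τ0 = τ0} (arrays u w) S
    correct notMissed k c = sound , λ (C≢0 , c≡C) → subst (Output {τ0 = τ0} (arrays u w) S k) (sym c≡C) (complete notMissed k C≢0)
      where
      sound : Output {τ0 = τ0} (arrays u w) S k c → C S k ≢ 0ℤ × c ≡ C S k
      sound output = decidable-stable (¬? (C S k ℤ.≟ 0ℤ) ×-dec (c ℤ.≟ C S k)) (λ wrong → rejects k c wrong output)

  good⇒correct : ∀ v → bad v ≡ false → Correct {τ0 = τ0} (λ a → H (lookup v a)) S
  good⇒correct v notBad = subst (λ v′ → Correct {τ0 = τ0} (λ a → H (lookup v′ a)) S) (VecP.take++drop≡id τ0 v)
    (correct (Vec.take τ0 v) (Vec.drop τ0 v) (∨-conicalʳ _ _ notBad) (∨-conicalˡ _ _ notBad))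

-- Counting the bad choices of arrays

^-distribʳ-* : ∀ a b t → (a * b) ^ t ≡ a ^ t * b ^ t
^-distribʳ-* a b zero    = refl
^-distribʳ-* a b (suc t) = trans (cong (a * b *_) (^-distribʳ-* a b t)) (regroup a b (a ^ t) (b ^ t))
  where
  regroup : ∀ a b x y → a * b * (x * y) ≡ a * x * (b * y)
  regroup = solve-∀

2^[k*t] : ∀ k t → 2 ^ (k * t) ≡ (2 ^ t) ^ k
2^[k*t] k t = trans (cong (2 ^_) (*-comm k t)) (sym (^-*-assoc 2 t k))

8^t : ∀ t → 8 ^ t ≡ (2 ^ t) ^ 3
8^t t = trans (^-*-assoc 2 3 t) (2^[k*t] 3 t)

8^[2t] : ∀ t → 8 ^ (2 * t) ≡ (2 ^ t) ^ 6
8^[2t] t = trans (^-*-assoc 2 3 (2 * t)) (trans (cong (2 ^_) (sym (*-assoc 3 2 t))) (2^[k*t] 6 t))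

-- 1 + t·2ᵗ ≤ 4ᵗ, from t < 2ᵗ.
1+t2^t≤4^t : ∀ t → 1 + t * 2 ^ t ≤ 2 ^ t * 2 ^ t
1+t2^t≤4^t t = ≤-trans (+-monoˡ-≤ (t * 2 ^ t) (m^n>0 2 t)) (*-monoˡ-≤ (2 ^ t) (n<2^n t))
  where
  n<2^n : ∀ t → suc t ≤ 2 ^ t
  n<2^n zero    = s≤s z≤n
  n<2^n (suc t) = ≤-trans (≤-reflexive (+-comm 1 (suc t))) (+-mono-≤ (n<2^n t) (≤-trans (m^n>0 2 t) (≤-reflexive (sym (+-identityʳ _)))))

-- With A = 2ᵗ, a bad seed either
-- misses an element (probability ≤ K/A³) or gives a heavy claim (probability
-- ≤ t·K·A⁴/A⁶), and K/A³ + tK/A² ≤ K/A because 1 + t·A ≤ A².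
failure-arith : ∀ t K B B₁ B₂ M₁ M₄ →
  B ≤ M₄ * B₁ + B₂ →
  B₁ * 8 ^ t ≤ K * M₁ →
  B₂ * 8 ^ (2 * t) ≤ M₁ * (t * (K * (2 ^ (4 * t) * M₄))) →
  B * 2 ^ t ≤ K * (M₁ * M₄)
failure-arith t K B B₁ B₂ M₁ M₄ split missing heavy =
  *-cancelʳ-≤ (B * A) (K * (M₁ * M₄)) (A ^ 6) {{m^n≢0 A 6 {{m^n≢0 2 t}}}} (begin
    B * A * A ^ 6
      ≤⟨ *-monoˡ-≤ (A ^ 6) (*-monoˡ-≤ A split) ⟩
    (M₄ * B₁ + B₂) * A * A ^ 6
      ≡⟨ expand M₄ B₁ B₂ A ⟩
    M₄ * A ^ 4 * (B₁ * A ^ 3) + A * (B₂ * A ^ 6)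
      ≤⟨ +-mono-≤ (*-monoʳ-≤ (M₄ * A ^ 4) missing′) (*-monoʳ-≤ A heavy′) ⟩
    M₄ * A ^ 4 * (K * M₁) + A * (M₁ * (t * (K * (A ^ 4 * M₄))))
      ≡⟨ factor M₄ A K M₁ t ⟩
    K * M₁ * M₄ * A ^ 4 * (1 + t * A)
      ≤⟨ *-monoʳ-≤ (K * M₁ * M₄ * A ^ 4) (1+t2^t≤4^t t) ⟩
    K * M₁ * M₄ * A ^ 4 * (A * A)
      ≡⟨ collect K M₁ M₄ A ⟩
    K * (M₁ * M₄) * A ^ 6 ∎)
  where
  open ≤-Reasoning
  A = 2 ^ t
  missing′ : B₁ * A ^ 3 ≤ K * M₁
  missing′ = subst (λ e → B₁ * e ≤ K * M₁) (8^t t) missing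
  heavy′ : B₂ * A ^ 6 ≤ M₁ * (t * (K * (A ^ 4 * M₄)))
  heavy′ = subst₂ (λ e f → B₂ * e ≤ M₁ * (t * (K * (f * M₄)))) (8^[2t] t) (2^[k*t] 4 t) heavy
  -- (ring identities, with aᵏ unfolded to a * (a * … * 1) as _^_ computes)
  expand : ∀ m b₁ b₂ a → (m * b₁ + b₂) * a * (a * (a * (a * (a * (a * (a * 1)))))) ≡
    m * (a * (a * (a * (a * 1)))) * (b₁ * (a * (a * (a * 1)))) + a * (b₂ * (a * (a * (a * (a * (a * (a * 1)))))))
  expand = solve-∀
  factor : ∀ m a k m₁ t → m * (a * (a * (a * (a * 1)))) * (k * m₁) + a * (m₁ * (t * (k * ((a * (a * (a * (a * 1)))) * m)))) ≡
    k * m₁ * m * (a * (a * (a * (a * 1)))) * (1 + t * a)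
  factor = solve-∀
  collect : ∀ k m₁ m a → k * m₁ * m * (a * (a * (a * (a * 1)))) * (a * a) ≡ k * (m₁ * m) * (a * (a * (a * (a * (a * (a * 1))))))
  collect = solve-∀

module BadSeeds {m N K : ℕ} .{{_ : NonZero K}} (S : Stream m) (H : Fin N → Hash m (8 * K))
                (pairwise : PairwiseIndependent H) (fewElements : numElements S ≤ K) (τ0 : ℕ) where
  open Sketches {m}
  open SeedSums N
  open Collisions {{m*n≢0 8 K}} S H pairwise
  open Run S H τ0

  P : Fin m → ℕ
  P x = ∑[ i < N ] 𝟙 (collides S (H i) x)

  rareCollision : ∀ x → 8 * P x ≤ N
  rareCollision x = *-cancelʳ-≤ (8 * P x) N K (begin
    8 * P x * K            ≡⟨ regroup (P x) K ⟩
    P x * (8 * K)          ≡⟨ cong (_* (8 * K)) (countFin≡∑ N (λ i → collides S (H i) x)) ⟨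
    collisionCount x * (8 * K) ≤⟨ collisionCount-bound x ⟩
    numElements S * N      ≤⟨ *-monoˡ-≤ N fewElements ⟩
    K * N                  ≡⟨ *-comm K N ⟩
    N * K                  ∎)
    where
    open ≤-Reasoning
    regroup : ∀ c k → 8 * c * k ≡ c * (8 * k)
    regroup = solve-∀

  -- Union bound over the elements, then independence of the τ0 candidate arrays.
  missed-union : ∀ u → 𝟙 (missed u) ≤ ∑[ x < m ] (𝟙 (isElem S x) * 𝟙 (allᶠ τ0 (λ a → collides S (H (lookup u a)) x)))
  missed-union u = ≤-trans (𝟙-anyᶠ m _)
    (≤-reflexive (sum-cong-≗ (λ x → 𝟙-∧ (isElem S x) (allᶠ τ0 (λ a → collides S (H (lookup u a)) x)))))

  missedCount : ∑ᵛ τ0 (𝟙 ∘ missed) * 8 ^ τ0 ≤ K * N ^ τ0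
  missedCount = begin
    ∑ᵛ τ0 (𝟙 ∘ missed) * 8 ^ τ0
      ≤⟨ *-monoˡ-≤ (8 ^ τ0) (∑ᵛ-mono τ0 missed-union) ⟩
    ∑ᵛ τ0 (λ u → ∑[ x < m ] (𝟙 (isElem S x) * allMissed x u)) * 8 ^ τ0
      ≡⟨ cong (_* 8 ^ τ0) (trans (∑ᵛ-comm τ0 m (λ u x → 𝟙 (isElem S x) * allMissed x u)) (sum-cong-≗ independent)) ⟩
    (∑[ x < m ] (𝟙 (isElem S x) * P x ^ τ0)) * 8 ^ τ0
      ≡⟨ sum-*ʳ (8 ^ τ0) (λ x → 𝟙 (isElem S x) * P x ^ τ0) ⟨
    ∑[ x < m ] (𝟙 (isElem S x) * P x ^ τ0 * 8 ^ τ0)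
      ≤⟨ sum-mono (λ x → ≤-trans (≤-reflexive (*-assoc (𝟙 (isElem S x)) _ _)) (*-monoʳ-≤ (𝟙 (isElem S x)) (rare^τ0 x))) ⟩
    ∑[ x < m ] (𝟙 (isElem S x) * N ^ τ0)
      ≡⟨ sum-*ʳ (N ^ τ0) (𝟙 ∘ isElem S) ⟩
    (∑[ x < m ] 𝟙 (isElem S x)) * N ^ τ0
      ≡⟨ cong (_* N ^ τ0) (countFin≡∑ m (isElem S)) ⟨
    numElements S * N ^ τ0
      ≤⟨ *-monoˡ-≤ (N ^ τ0) fewElements ⟩
    K * N ^ τ0 ∎
    where
    open ≤-Reasoning
    allMissed : Fin m → Vec (Fin N) τ0 → ℕ
    allMissed x u = 𝟙 (allᶠ τ0 (λ a → collides S (H (lookup u a)) x))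
    independent : ∀ x → ∑ᵛ τ0 (λ u → 𝟙 (isElem S x) * allMissed x u) ≡ 𝟙 (isElem S x) * P x ^ τ0
    independent x = trans (∑ᵛ-*ˡ τ0 (𝟙 (isElem S x)) (allMissed x))
                          (cong (𝟙 (isElem S x) *_) (∑ᵛ-allᶠ τ0 (λ i → collides S (H i) x)))
    rare^τ0 : ∀ x → P x ^ τ0 * 8 ^ τ0 ≤ N ^ τ0
    rare^τ0 x = begin
      P x ^ τ0 * 8 ^ τ0 ≡⟨ ^-distribʳ-* (P x) 8 τ0 ⟨
      (P x * 8) ^ τ0    ≤⟨ ^-monoˡ-≤ τ0 (≤-trans (≤-reflexive (*-comm (P x) 8)) (rareCollision x)) ⟩
      N ^ τ0            ∎

  R : ℕ
  R = 2 ^ (4 * τ0) * N ^ (4 * τ0)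

  heavyCount : ∀ k → ∑ᵛ (4 * τ0) (𝟙 ∘ heavy k) * 8 ^ (2 * τ0) ≤ R
  heavyCount k = TailBound.tail-bound N (λ i → collides S (H i) k) (rareCollision k) (4 * τ0) (2 * τ0)

  heavyClaimsIn : Vec (Fin N) (4 * τ0) → Fin N → ℕ
  heavyClaimsIn w i = ∑[ b < 8 * K ] ∑[ k < m ] (𝟙 (claims (binSketch (H i) S b) k) * 𝟙 (heavy k w))

  heavyClaim-union : ∀ u w → 𝟙 (heavyClaim u w) ≤ ∑[ a < τ0 ] heavyClaimsIn w (lookup u a)
  heavyClaim-union u w = ≤-trans (𝟙-anyᶠ τ0 _) (sum-mono λ a → ≤-trans (𝟙-anyᶠ (8 * K) _) (sum-mono λ b →
    ≤-trans (𝟙-anyᶠ m _) (≤-reflexive (sum-cong-≗ λ k → 𝟙-∧ (claims (binSketch (H (lookup u a)) S b) k) (heavy k w)))))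

  -- An array claims at most one key per passing bin, so at most K keys in
  -- all, each of them heavy with small probability.
  heavyClaimsIn-count : ∀ i → ∑ᵛ (4 * τ0) (λ w → heavyClaimsIn w i) * 8 ^ (2 * τ0) ≤ K * R
  heavyClaimsIn-count i = begin
    ∑ᵛ (4 * τ0) (λ w → ∑[ b < 8 * K ] ∑[ k < m ] (claim b k * 𝟙 (heavy k w))) * E
      ≡⟨ cong (_* E) swap ⟩
    (∑[ b < 8 * K ] ∑[ k < m ] (claim b k * heavyTotal k)) * E
      ≡⟨ trans (sum-cong-≗ λ b → trans (sum-cong-≗ λ k → sym (*-assoc (claim b k) (heavyTotal k) E))
                                         (sum-*ʳ E (λ k → claim b k * heavyTotal k)))
               (sum-*ʳ E (λ b → ∑[ k < m ] (claim b k * heavyTotal k))) ⟨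
    ∑[ b < 8 * K ] ∑[ k < m ] (claim b k * (heavyTotal k * E))
      ≤⟨ sum-mono (λ b → sum-mono λ k → *-monoʳ-≤ (claim b k) (heavyCount k)) ⟩
    ∑[ b < 8 * K ] ∑[ k < m ] (claim b k * R)
      ≡⟨ trans (sum-cong-≗ λ b → sum-*ʳ R (claim b)) (sum-*ʳ R (λ b → ∑[ k < m ] claim b k)) ⟩
    (∑[ b < 8 * K ] ∑[ k < m ] claim b k) * R
      ≤⟨ *-monoˡ-≤ R (≤-trans (sum-mono {f = λ b → ∑[ k < m ] claim b k} (λ b → claims-unique (binSketch (H i) S b)))
                              (≤-trans (passingBins≤elements (H i) S) fewElements)) ⟩
    K * R ∎
    where
    open ≤-Reasoning
    E = 8 ^ (2 * τ0)
    claim : Fin (8 * K) → Fin m → ℕ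
    claim b k = 𝟙 (claims (binSketch (H i) S b) k)
    heavyTotal : Fin m → ℕ
    heavyTotal k = ∑ᵛ (4 * τ0) (𝟙 ∘ heavy k)
    swap : ∑ᵛ (4 * τ0) (λ w → ∑[ b < 8 * K ] ∑[ k < m ] (claim b k * 𝟙 (heavy k w)))
         ≡ ∑[ b < 8 * K ] ∑[ k < m ] (claim b k * heavyTotal k)
    swap = trans (∑ᵛ-comm (4 * τ0) (8 * K) (λ w b → ∑[ k < m ] (claim b k * 𝟙 (heavy k w))))
      (sum-cong-≗ λ b → trans (∑ᵛ-comm (4 * τ0) m (λ w k → claim b k * 𝟙 (heavy k w)))
        (sum-cong-≗ λ k → ∑ᵛ-*ˡ (4 * τ0) (claim b k) (𝟙 ∘ heavy k)))

  heavyClaimCount : ∑ᵛ τ0 (λ u → ∑ᵛ (4 * τ0) (λ w → 𝟙 (heavyClaim u w))) * 8 ^ (2 * τ0) ≤ N ^ τ0 * (τ0 * (K * R))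
  heavyClaimCount = begin
    ∑ᵛ τ0 (λ u → ∑ᵛ (4 * τ0) (λ w → 𝟙 (heavyClaim u w))) * E
      ≤⟨ *-monoˡ-≤ E (∑ᵛ-mono τ0 λ u → ∑ᵛ-mono (4 * τ0) λ w → heavyClaim-union u w) ⟩
    ∑ᵛ τ0 (λ u → ∑ᵛ (4 * τ0) (λ w → ∑[ a < τ0 ] heavyClaimsIn w (lookup u a))) * E
      ≡⟨ ∑ᵛ-*ʳ τ0 E _ ⟨
    ∑ᵛ τ0 (λ u → ∑ᵛ (4 * τ0) (λ w → ∑[ a < τ0 ] heavyClaimsIn w (lookup u a)) * E)
      ≡⟨ ∑ᵛ-cong τ0 (λ u → trans (cong (_* E) (∑ᵛ-comm (4 * τ0) τ0 λ w a → heavyClaimsIn w (lookup u a)))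
                                 (sym (sum-*ʳ E λ a → ∑ᵛ (4 * τ0) λ w → heavyClaimsIn w (lookup u a)))) ⟩
    ∑ᵛ τ0 (λ u → ∑[ a < τ0 ] (∑ᵛ (4 * τ0) (λ w → heavyClaimsIn w (lookup u a)) * E))
      ≤⟨ ∑ᵛ-mono τ0 (λ u → sum-mono λ a → heavyClaimsIn-count (lookup u a)) ⟩
    ∑ᵛ τ0 (λ u → ∑[ a < τ0 ] (K * R))
      ≡⟨ trans (∑ᵛ-cong τ0 λ u → sum-const τ0 (K * R)) (∑ᵛ-const τ0 (τ0 * (K * R))) ⟩
    N ^ τ0 * (τ0 * (K * R)) ∎
    where
    open ≤-Reasoning
    E = 8 ^ (2 * τ0)

  badCount-split : ∑ᵛ (5 * τ0) (𝟙 ∘ bad) ≤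
    N ^ (4 * τ0) * ∑ᵛ τ0 (𝟙 ∘ missed) + ∑ᵛ τ0 (λ u → ∑ᵛ (4 * τ0) (λ w → 𝟙 (heavyClaim u w)))
  badCount-split = begin
    ∑ᵛ (τ0 + 4 * τ0) (𝟙 ∘ bad)
      ≡⟨ ∑ᵛ-++ τ0 (4 * τ0) (𝟙 ∘ bad) ⟩
    ∑ᵛ τ0 (λ u → ∑ᵛ (4 * τ0) (λ w → 𝟙 (bad (u ++ w))))
      ≡⟨ ∑ᵛ-cong τ0 (λ u → ∑ᵛ-cong (4 * τ0) λ w → cong₂ (λ u′ w′ → 𝟙 (missed u′ ∨ heavyClaim u′ w′))
                                                          (proj₁ (take-drop-++ u w)) (proj₂ (take-drop-++ u w))) ⟩
    ∑ᵛ τ0 (λ u → ∑ᵛ (4 * τ0) (λ w → 𝟙 (missed u ∨ heavyClaim u w)))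
      ≤⟨ ∑ᵛ-mono τ0 (λ u → ∑ᵛ-mono (4 * τ0) λ w → 𝟙-∨ (missed u) (heavyClaim u w)) ⟩
    ∑ᵛ τ0 (λ u → ∑ᵛ (4 * τ0) (λ w → 𝟙 (missed u) + 𝟙 (heavyClaim u w)))
      ≡⟨ ∑ᵛ-cong τ0 (λ u → trans (∑ᵛ-+ (4 * τ0) (λ _ → 𝟙 (missed u)) (λ w → 𝟙 (heavyClaim u w)))
                                 (cong (_+ ∑ᵛ (4 * τ0) (λ w → 𝟙 (heavyClaim u w))) (∑ᵛ-const (4 * τ0) (𝟙 (missed u))))) ⟩
    ∑ᵛ τ0 (λ u → N ^ (4 * τ0) * 𝟙 (missed u) + ∑ᵛ (4 * τ0) (λ w → 𝟙 (heavyClaim u w)))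
      ≡⟨ trans (∑ᵛ-+ τ0 (λ u → N ^ (4 * τ0) * 𝟙 (missed u)) heavyClaims)
               (cong (_+ ∑ᵛ τ0 heavyClaims) (∑ᵛ-*ˡ τ0 (N ^ (4 * τ0)) (𝟙 ∘ missed))) ⟩
    N ^ (4 * τ0) * ∑ᵛ τ0 (𝟙 ∘ missed) + ∑ᵛ τ0 heavyClaims ∎
    where
    open ≤-Reasoning
    heavyClaims : Vec (Fin N) τ0 → ℕ
    heavyClaims u = ∑ᵛ (4 * τ0) (λ w → 𝟙 (heavyClaim u w))

  badCount : ∑ᵛ (5 * τ0) (𝟙 ∘ bad) * 2 ^ τ0 ≤ K * N ^ (5 * τ0)
  badCount = subst (λ n → ∑ᵛ (5 * τ0) (𝟙 ∘ bad) * 2 ^ τ0 ≤ K * n) (sym (^-distribˡ-+-* N τ0 (4 * τ0)))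
    (failure-arith τ0 K _ _ _ (N ^ τ0) (N ^ (4 * τ0)) badCount-split missedCount heavyClaimCount)

module FromCounts where
  open import Data.Integer using (+_)
  import Data.Nat.Coprimality as Coprime
  import Data.Rational.Unnormalised as ℚᵘ
  import Data.Rational.Unnormalised.Properties as ℚᵘP

  ι : ℕ → ℚ
  ι n = ℚ.mkℚ (+ n) 0 (Coprime.sym (Coprime.1-coprimeTo n))

  ℕtoℚ≡mkℚ : ∀ n → ℕtoℚ n ≡ ι n
  ℕtoℚ≡mkℚ n = ℚP.normalize-coprime (Coprime.sym (Coprime.1-coprimeTo n))

  ℕtoℚ-* : ∀ a b → ℕtoℚ (a * b) ≡ ℕtoℚ a ℚ.* ℕtoℚ b
  ℕtoℚ-* a b rewrite ℕtoℚ≡mkℚ (a * b) | ℕtoℚ≡mkℚ a | ℕtoℚ≡mkℚ b =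
    ℚP.toℚᵘ-injective (ℚᵘP.≃-trans (ℚᵘ.*≡* (cong (ℤ._* + 1) (ℤP.pos-* a b)))
                                   (ℚᵘP.≃-sym (ℚP.toℚᵘ-homo-* (ι a) (ι b))))

  ℕtoℚ-+ : ∀ a b → ℕtoℚ (a + b) ≡ ℕtoℚ a ℚ.+ ℕtoℚ b
  ℕtoℚ-+ a b rewrite ℕtoℚ≡mkℚ (a + b) | ℕtoℚ≡mkℚ a | ℕtoℚ≡mkℚ b =
    ℚP.toℚᵘ-injective (ℚᵘP.≃-trans (ℚᵘ.*≡* (cong (ℤ._* + 1) pos-+)) (ℚᵘP.≃-sym (ℚP.toℚᵘ-homo-+ (ι a) (ι b))))
    where
    pos-+ : + (a + b) ≡ + a ℤ.* + 1 ℤ.+ + b ℤ.* + 1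
    pos-+ = trans (ℤP.pos-+ a b) (cong₂ ℤ._+_ (sym (ℤP.*-identityʳ (+ a))) (sym (ℤP.*-identityʳ (+ b))))

  ℕtoℚ-mono : ∀ {a b} → a ≤ b → ℕtoℚ a ℚ.≤ ℕtoℚ b
  ℕtoℚ-mono {a} {b} a≤b rewrite ℕtoℚ≡mkℚ a | ℕtoℚ≡mkℚ b =
    ℚ.*≤* (subst₂ ℤ._≤_ (sym (ℤP.*-identityʳ (+ a))) (sym (ℤP.*-identityʳ (+ b))) (ℤ.+≤+ a≤b))

  ℕtoℚ-nonNegative : ∀ n → ℚ.NonNegative (ℕtoℚ n)
  ℕtoℚ-nonNegative n rewrite ℕtoℚ≡mkℚ n = _

  ℕtoℚ-positive : ∀ n .{{_ : NonZero n}} → ℚ.Positive (ℕtoℚ n)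
  ℕtoℚ-positive (suc n) rewrite ℕtoℚ≡mkℚ (suc n) = _

  goodFraction : ∀ δ K P .{{_ : NonZero P}} T G B → G + B ≡ T → B * P ≤ K * T → ℕtoℚ K ℚ.≤ δ ℚ.* ℕtoℚ P →
    (1ℚ ℚ.- δ) ℚ.* ℕtoℚ T ℚ.≤ ℕtoℚ G
  goodFraction δ K P T G B G+B≡T few K≤δp = begin
    (1ℚ ℚ.- δ) ℚ.* t          ≡⟨ ℚP.*-distribʳ-+ t 1ℚ (ℚ.- δ) ⟩
    1ℚ ℚ.* t ℚ.+ ℚ.- δ ℚ.* t  ≡⟨ cong₂ ℚ._+_ (ℚP.*-identityˡ t) (sym (ℚP.neg-distribˡ-* δ t)) ⟩
    t ℚ.- δ ℚ.* t             ≤⟨ ℚP.+-monoʳ-≤ t (ℚP.neg-antimono-≤ b≤δt) ⟩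
    t ℚ.- b                   ≡⟨ cong (ℚ._- b) (trans (cong ℕtoℚ (sym G+B≡T)) (ℕtoℚ-+ G B)) ⟩
    ℕtoℚ G ℚ.+ b ℚ.- b        ≡⟨ ℚP.+-assoc (ℕtoℚ G) b (ℚ.- b) ⟩
    ℕtoℚ G ℚ.+ (b ℚ.- b)      ≡⟨ cong (ℕtoℚ G ℚ.+_) (ℚP.+-inverseʳ b) ⟩
    ℕtoℚ G ℚ.+ 0ℚ             ≡⟨ ℚP.+-identityʳ (ℕtoℚ G) ⟩
    ℕtoℚ G                    ∎
    where
    open ℚP.≤-Reasoning
    t = ℕtoℚ T
    b = ℕtoℚ B
    p = ℕtoℚ P
    instance
      p-positive : ℚ.Positive p
      p-positive = ℕtoℚ-positive P
      t-nonNegative : ℚ.NonNegative t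
      t-nonNegative = ℕtoℚ-nonNegative T
    b≤δt : b ℚ.≤ δ ℚ.* t
    b≤δt = ℚP.*-cancelʳ-≤-pos p (begin
      b ℚ.* p             ≡⟨ ℕtoℚ-* B P ⟨
      ℕtoℚ (B * P)        ≤⟨ ℕtoℚ-mono few ⟩
      ℕtoℚ (K * T)        ≡⟨ ℕtoℚ-* K T ⟩
      ℕtoℚ K ℚ.* t        ≤⟨ ℚP.*-monoʳ-≤-nonNeg t K≤δp ⟩
      δ ℚ.* p ℚ.* t       ≡⟨ ℚP.*-assoc δ p t ⟩
      δ ℚ.* (p ℚ.* t)     ≡⟨ cong (δ ℚ.*_) (ℚP.*-comm p t) ⟩
      δ ℚ.* (t ℚ.* p)     ≡⟨ ℚP.*-assoc δ t p ⟨
      δ ℚ.* t ℚ.* p       ∎)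


module Listing (N : ℕ) where
  open SeedSums N

  concatᶠ : ∀ {A : Set} k → (Fin k → List A) → List A
  concatᶠ zero    F = []
  concatᶠ (suc k) F = F Fin.zero List.++ concatᶠ k (F ∘ Fin.suc)

  seedsWith : ∀ n → (Seeds n → Bool) → List (Seeds n)
  seedsWith zero    p = if p [] then [] ∷ [] else []
  seedsWith (suc n) p = concatᶠ N (λ i → List.map (i ∷_) (seedsWith n (p ∘ (i ∷_))))

  length-concatᶠ : ∀ {A : Set} k (F : Fin k → List A) → length (concatᶠ k F) ≡ ∑[ j < k ] length (F j)
  length-concatᶠ zero    F = refl
  length-concatᶠ (suc k) F = trans (ListP.length-++ (F Fin.zero)) (cong (length (F Fin.zero) +_) (length-concatᶠ k (F ∘ Fin.suc)))

  length-seedsWith : ∀ n p → length (seedsWith n p) ≡ ∑ᵛ n (𝟙 ∘ p)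
  length-seedsWith zero p with p []
  ... | true  = refl
  ... | false = refl
  length-seedsWith (suc n) p = trans (length-concatᶠ N _)
    (sum-cong-≗ λ i → trans (ListP.length-map (i ∷_) (seedsWith n (p ∘ (i ∷_)))) (length-seedsWith n (p ∘ (i ∷_))))

  ∈-concatᶠ : ∀ {A : Set} k (F : Fin k → List A) {x} → x ∈ concatᶠ k F → ∃[ j ] x ∈ F j
  ∈-concatᶠ (suc k) F x∈ with ∈-++⁻ (F Fin.zero) x∈
  ... | inj₁ x∈F₀ = Fin.zero , x∈F₀
  ... | inj₂ x∈rest = let (j , x∈Fⱼ) = ∈-concatᶠ k (F ∘ Fin.suc) x∈rest in Fin.suc j , x∈Fⱼ

  ∈-seedsWith : ∀ n p {v} → v ∈ seedsWith n p → p v ≡ true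
  ∈-seedsWith zero p {[]} v∈ with p []
  ... | true  = refl
  ... | false with () ← v∈
  ∈-seedsWith (suc n) p v∈ with ∈-concatᶠ N _ v∈
  ... | i , v∈ᵢ with ∈-map⁻ (i ∷_) v∈ᵢ
  ... | w , w∈ , refl = ∈-seedsWith n (p ∘ (i ∷_)) w∈

  unique-concatᶠ : ∀ {n} k (φ : Fin k → Fin N) → (∀ i j → φ i ≡ φ j → i ≡ j) → (L : Fin k → List (Seeds n)) →
    (∀ j → Unique (L j)) → Unique (concatᶠ k (λ j → List.map (φ j ∷_) (L j)))
  unique-concatᶠ zero    φ φ-inj L unique = []
  unique-concatᶠ (suc k) φ φ-inj L unique =
    ++⁺ (map⁺ VecP.∷-injectiveʳ (unique Fin.zero))
        (unique-concatᶠ k (φ ∘ Fin.suc) (λ i j eq → FinP.suc-injective (φ-inj (Fin.suc i) (Fin.suc j) eq))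
                        (L ∘ Fin.suc) (unique ∘ Fin.suc))
        disjoint
    where
    disjoint : ∀ {v} → v ∈ List.map (φ Fin.zero ∷_) (L Fin.zero) ×
                       v ∈ concatᶠ k (λ j → List.map (φ (Fin.suc j) ∷_) (L (Fin.suc j))) → ⊥
    disjoint (v∈₀ , v∈rest) with ∈-map⁻ (φ Fin.zero ∷_) v∈₀ | ∈-concatᶠ k _ v∈rest
    ... | _ , _ , refl | j , v∈ⱼ with ∈-map⁻ (φ (Fin.suc j) ∷_) v∈ⱼ
    ... | _ , _ , eq with () ← φ-inj Fin.zero (Fin.suc j) (VecP.∷-injectiveˡ eq)

  unique-seedsWith : ∀ n p → Unique (seedsWith n p)
  unique-seedsWith zero p with p []
  ... | true  = All.[] ∷ []
  ... | false = []
  unique-seedsWith (suc n) p = unique-concatᶠ N (λ i → i) (λ i j eq → eq) _ (λ i → unique-seedsWith n (p ∘ (i ∷_)))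

lemma7 : (δ : ℚ) → 0ℚ ℚ.< δ → δ ℚ.< 1ℚ →
    (K : ℕ) → 1 ℕ.≤ K →
    (m : ℕ) → (S : Stream m) → numElements S ℕ.≤ K →
    (τ0 : ℕ) → ℕtoℚ K ℚ.≤ δ ℚ.* ℕtoℚ (2 ℕ.^ τ0) → δ ℚ.* ℕtoℚ (2 ℕ.^ (τ0 ℕ.∸ 1)) ℚ.< ℕtoℚ K →
    (N : ℕ) → 1 ℕ.≤ N → (H : Fin N → Hash m (8 ℕ.* K)) → PairwiseIndependent H →
    ∃[ L ] (Unique L × All (λ (v : Vec (Fin N) (5 ℕ.* τ0)) → Correct {τ0 = τ0} (λ a → H (lookup v a)) S) L
    × (1ℚ ℚ.- δ) ℚ.* ℕtoℚ (N ℕ.^ (5 ℕ.* τ0)) ℚ.≤ ℕtoℚ (length L))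
lemma7 δ _ _ K 1≤K m S fewElements τ0 K≤δ2^τ0 _ N _ H pairwise =
  goodSeeds , unique-seedsWith (5 * τ0) good , All.tabulate goodSeeds-correct , enoughGoodSeeds
  where
  instance
    K≢0 : NonZero K
    K≢0 = ℕ.>-nonZero 1≤K
  open Run S H τ0 using (bad; good⇒correct)
  open BadSeeds S H pairwise fewElements τ0 using (badCount)
  open SeedSums N using (∑ᵛ; ∑ᵛ-complement)
  open Listing N using (seedsWith; unique-seedsWith; ∈-seedsWith; length-seedsWith)
  open FromCounts using (goodFraction)
  good : Vec (Fin N) (5 * τ0) → Bool
  good = not ∘ bad
  goodSeeds : List (Vec (Fin N) (5 * τ0))
  goodSeeds = seedsWith (5 * τ0) good
  goodSeeds-correct : ∀ {v} → v ∈ goodSeeds → Correct {τ0 = τ0} (λ a → H (lookup v a)) S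
  goodSeeds-correct {v} v∈ =
    good⇒correct v (trans (sym (not-involutive (bad v))) (cong not (∈-seedsWith (5 * τ0) good v∈)))
  enoughGoodSeeds : (1ℚ ℚ.- δ) ℚ.* ℕtoℚ (N ^ (5 * τ0)) ℚ.≤ ℕtoℚ (length goodSeeds)
  enoughGoodSeeds =
    subst (λ n → (1ℚ ℚ.- δ) ℚ.* ℕtoℚ (N ^ (5 * τ0)) ℚ.≤ ℕtoℚ n) (sym (length-seedsWith (5 * τ0) good))
    (goodFraction δ K (2 ^ τ0) {{m^n≢0 2 τ0}} (N ^ (5 * τ0)) (∑ᵛ (5 * τ0) (𝟙 ∘ good)) (∑ᵛ (5 * τ0) (𝟙 ∘ bad))
                  (∑ᵛ-complement (5 * τ0) bad) badCount K≤δ2^τ0)
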